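{- Let $G$ be a connected graph with $\chi_D(G)=2$. Then $\chi_D(G\cup G)=3$ if and only if $G$ is a bipartite graph whose automorphism group is $\mathrm{Aut}(G)\cong\mathbb{Z}_2=\{\mathrm{id},f\}$, where $\mathrm{Fix}(f)=\emptyset$ and $f$ maps each of the two parts of the bipartition of $G$ onto the other.
   Context: $G\cup G$ is the disjoint union of two copies of $G$. A distinguishing $k$-coloring of a graph is a partition of its vertex set into exactly $k$ non-empty independent sets such that the only automorphism mapping every class onto itself is the identity; $\chi_D$ is the least such $k$. For $f\in\mathrm{Aut}(G)$, $\mathrm{Fix}(f)=\{v\in V(G): f(v)=v\}$. -}

module Defs where

open import Data.Nat using (ℕ; _+_; _<_)
open import Data.Fin using (Fin; splitAt)
open import Data.Fin.Permutation using (Permutation′; _⟨$⟩ʳ_)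
open import Data.Bool using (Bool; true; false; not)
open import Data.Sum using (_⊎_; inj₁; inj₂)
open import Data.Product using (Σ; _×_; ∃; _,_)
open import Function.Definitions using (Surjective)
open import Relation.Binary.PropositionalEquality using (_≡_; _≢_)
open import Relation.Nullary using (¬_)

record Graph (n : ℕ) : Set where
  field
    adj   : Fin n → Fin n → Bool
    sym   : ∀ u v → adj u v ≡ adj v u
    irref : ∀ v → adj v v ≡ false
open Graph public

Adj : ∀ {n} → Graph n → Fin n → Fin n → Set
Adj G u v = adj G u v ≡ true

data Reach {n} (G : Graph n) : Fin n → Fin n → Set where
  here : ∀ {v} → Reach G v v
  step : ∀ {u v w} → Adj G u v → Reach G v w → Reach G u w

Connected : ∀ {n} → Graph n → Set
Connected {n} G = ∀ (u v : Fin n) → Reach G u v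

IsAut : ∀ {n} → Graph n → Permutation′ n → Set
IsAut {n} G f = ∀ (u v : Fin n) → adj G (f ⟨$⟩ʳ u) (f ⟨$⟩ʳ v) ≡ adj G u v

IsIdentity : ∀ {n} → Permutation′ n → Set
IsIdentity {n} f = ∀ (v : Fin n) → f ⟨$⟩ʳ v ≡ v

Proper : ∀ {n k} → Graph n → (Fin n → Fin k) → Set
Proper {n} G c = ∀ (u v : Fin n) → Adj G u v → c u ≢ c v

-- Distinguishing k-colouring: partition into exactly k non-empty
-- independent classes (c surjective onto Fin k, proper) such that the only
-- automorphism mapping every class onto itself is the identity.
DistColoring : ∀ {n} → Graph n → (k : ℕ) → Set
DistColoring {n} G k =
  Σ (Fin n → Fin k) λ c →
    Surjective _≡_ _≡_ c × Proper G c ×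
    (∀ f → IsAut G f → (∀ v → c (f ⟨$⟩ʳ v) ≡ c v) → IsIdentity f)

ChiD≡ : ∀ {n} → Graph n → ℕ → Set
ChiD≡ G k = DistColoring G k × (∀ j → j < k → ¬ DistColoring G j)

unionAdj : ∀ {n} → Graph n → Fin (n + n) → Fin (n + n) → Bool
unionAdj {n} G u v with splitAt n u | splitAt n v
... | inj₁ a | inj₁ b = adj G a b
... | inj₂ a | inj₂ b = adj G a b
... | inj₁ _ | inj₂ _ = false
... | inj₂ _ | inj₁ _ = false

unionSym : ∀ {n} (G : Graph n) u v → unionAdj G u v ≡ unionAdj G v u
unionSym {n} G u v with splitAt n u | splitAt n v
... | inj₁ a | inj₁ b = sym G a b
... | inj₂ a | inj₂ b = sym G a b
... | inj₁ _ | inj₂ _ = _≡_.refl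
... | inj₂ _ | inj₁ _ = _≡_.refl

unionIrr : ∀ {n} (G : Graph n) v → unionAdj G v v ≡ false
unionIrr {n} G v with splitAt n v
... | inj₁ a = irref G a
... | inj₂ a = irref G a

_∪G_ : ∀ {n} → Graph n → Graph n → Graph (n + n)
_∪G_ G _ = record { adj = unionAdj G ; sym = unionSym G ; irref = unionIrr G }

-- Bipartition: a proper 2-colouring side : V → Bool (the two parts are
-- side ⁻¹ true and side ⁻¹ false).
IsBipartition : ∀ {n} → Graph n → (Fin n → Bool) → Set
IsBipartition {n} G side = ∀ (u v : Fin n) → Adj G u v → side u ≢ side v

Fix∅ : ∀ {n} → Permutation′ n → Set
Fix∅ {n} f = ∀ (v : Fin n) → f ⟨$⟩ʳ v ≢ v

-- Aut(G) = {id, f} with f ≠ id (hence Aut(G) ≅ ℤ₂).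
AutIsIdF : ∀ {n} → Graph n → Permutation′ n → Set
AutIsIdF {n} G f =
  IsAut G f × ¬ IsIdentity f ×
  (∀ g → IsAut G g → IsIdentity g ⊎ (∀ (v : Fin n) → g ⟨$⟩ʳ v ≡ f ⟨$⟩ʳ v))

SpecialBipartite : ∀ {n} → Graph n → Set
SpecialBipartite {n} G =
  Σ (Fin n → Bool) λ side → IsBipartition G side ×
  Σ (Permutation′ n) λ f → AutIsIdF G f × Fix∅ f ×
    (∀ (v : Fin n) → side (f ⟨$⟩ʳ v) ≡ not (side v))

-- Let s be the side function of a distinguishing 2-colouring of G. On a connected graph
-- any proper 2-colouring equals s or its complement, so every automorphism of G either
-- preserves s (and is then the identity) or swaps the two sides.
-- If some automorphism f swaps the sides, it is the only non-identity automorphism, and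
-- any proper 2-colouring of G ∪ G is invariant under the automorphism exchanging the two
-- copies through f (or through id); so χ_D(G ∪ G) > 2, and colouring the first copy with
-- {0,1} and the second with {0,2} according to s distinguishes G ∪ G.
-- If no automorphism swaps the sides, colouring the first copy by s and the second by the
-- complement of s is a distinguishing 2-colouring of G ∪ G: an automorphism preserving it
-- either keeps both copies in place, hence is the identity, or exchanges them, and its
-- restriction to a copy would swap the sides.
-- Constructively, the witness f is found by exhaustive search over maps Fin n → Fin n.
module Submission where

open import Data.Bool using (Bool; true; false; not)
open import Data.Bool.Properties using (not-involutive; not-injective; not-¬; ¬-not)
  renaming (_≟_ to _≟ᵇ_)
open import Data.Empty using (⊥-elim)
open import Data.Fin using (Fin; zero; suc; join; splitAt; punchOut)
open import Data.Fin.Permutation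
  using (Permutation′; _⟨$⟩ʳ_; _⟨$⟩ˡ_; inverseˡ; inverseʳ; permutation; _∘ₚ_)
import Data.Fin.Permutation as Perm
open import Data.Fin.Properties
  using ( _≟_; any?; all?; splitAt-join; join-splitAt; punchOut-injective; <⇒notInjective
        ; 2↔Bool)
open import Data.Nat using (ℕ; zero; suc; _+_; _<_; s≤s)
open import Data.Nat.Properties using (n<1+n)
open import Data.Product using (Σ; ∃; ∃₂; _×_; _,_; proj₁; proj₂)
open import Data.Sum using (_⊎_; inj₁; inj₂; [_,_]′)
open import Data.Vec.Functional using (_∷_; head; tail)
open import Defs hiding (sym)
open import Function using (_∘_; id)
open import Function.Bundles using (_⇔_; mk⇔; Inverse; Injection)
open import Function.Consequences.Propositional
  using (strictlySurjective⇒surjective; surjective⇒strictlySurjective)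
open import Function.Definitions using (Injective; Surjective)
open import Function.Properties.Inverse using (↔⇒↣)
open import Relation.Binary.PropositionalEquality
  using (_≡_; _≢_; refl; sym; trans; cong; cong₂; subst; _≗_; module ≡-Reasoning)
open import Relation.Nullary using (¬_; Dec; yes; no; contradiction)
open import Relation.Nullary.Decidable using (map′; _×-dec_; _→-dec_)

private
  variable
    n m k : ℕ
    A B : Set

toBool : Fin 2 → Bool
toBool = Inverse.to 2↔Bool

fromBool : Bool → Fin 2
fromBool = Inverse.from 2↔Bool

toBool-fromBool : ∀ b → toBool (fromBool b) ≡ b
toBool-fromBool = Inverse.strictlyInverseˡ 2↔Bool

toBool-injective : Injective _≡_ _≡_ toBool
toBool-injective = Injection.injective (↔⇒↣ 2↔Bool)

fromBool-injective : Injective _≡_ _≡_ fromBool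
fromBool-injective {x} {y} e =
  trans (sym (toBool-fromBool x)) (trans (cong toBool e) (toBool-fromBool y))

∃-function? : {P : (Fin m → Fin k) → Set} → (∀ {f g} → f ≗ g → P f → P g) →
              (∀ f → Dec (P f)) → Dec (∃ P)
∃-function? {zero} resp P? with P? (λ ())
... | yes p = yes (_ , p)
... | no ¬p = no λ (f , p) → ¬p (resp (λ ()) p)
∃-function? {suc m} {P = P} resp P? =
  map′ (λ (x , t , p) → x ∷ t , p) (λ (f , p) → head f , tail f , resp head∷tail p)
    (any? λ x → ∃-function? (λ f≗g → resp (cons-resp f≗g)) (λ t → P? (x ∷ t)))
  where
  head∷tail : ∀ {f : Fin (suc m) → Fin k} → f ≗ (head f ∷ tail f)
  head∷tail zero    = refl
  head∷tail (suc _) = refl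
  cons-resp : ∀ {x} {f g : Fin m → Fin k} → f ≗ g → (x ∷ f) ≗ (x ∷ g)
  cons-resp f≗g zero    = refl
  cons-resp f≗g (suc i) = f≗g i

injective⇒surjective : {g : Fin n → Fin n} → Injective _≡_ _≡_ g →
                       ∀ y → ∃ λ x → g x ≡ y
injective⇒surjective {suc n} {g} g-inj y with any? (λ x → g x ≟ y)
... | yes hit = hit
... | no miss = ⊥-elim (<⇒notInjective (n<1+n n) punchOut∘g-injective)
  where
  punchOut∘g : Fin (suc n) → Fin n
  punchOut∘g x = punchOut (λ y≡gx → miss (x , sym y≡gx))
  punchOut∘g-injective : Injective _≡_ _≡_ punchOut∘g
  punchOut∘g-injective {x} {x'} =
    g-inj ∘ punchOut-injective (λ y≡gx → miss (x , sym y≡gx))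
                               (λ y≡gx' → miss (x' , sym y≡gx'))

-- Its forward map is g itself, definitionally.
injective⇒permutation : {g : Fin n → Fin n} → Injective _≡_ _≡_ g → Permutation′ n
injective⇒permutation {g = g} g-inj =
  permutation g (proj₁ ∘ onto) (proj₂ ∘ onto) (λ x → g-inj (proj₂ (onto (g x))))
  where onto = injective⇒surjective g-inj

⟨$⟩ʳ-injective : (π : Permutation′ n) → Injective _≡_ _≡_ (π ⟨$⟩ʳ_)
⟨$⟩ʳ-injective π = Injection.injective (↔⇒↣ π)

AdjacencyPreserving : Graph n → (Fin n → Fin n) → Set
AdjacencyPreserving G g = ∀ u v → adj G (g u) (g v) ≡ adj G u v

ProperColouring : Graph n → (Fin n → A) → Set
ProperColouring G c = ∀ u v → Adj G u v → c u ≢ c v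

Distinguishes : Graph n → (Fin n → A) → Set
Distinguishes G c = ∀ f → IsAut G f → (∀ v → c (f ⟨$⟩ʳ v) ≡ c v) → IsIdentity f

proper-∘ : {G : Graph n} {c : Fin n → A} {κ : A → B} →
           Injective _≡_ _≡_ κ → ProperColouring G c → ProperColouring G (κ ∘ c)
proper-∘ κ-inj proper u v e = proper u v e ∘ κ-inj

distinguishes-∘ : {G : Graph n} {c : Fin n → A} {κ : A → B} →
                  Injective _≡_ _≡_ κ → Distinguishes G c → Distinguishes G (κ ∘ c)
distinguishes-∘ κ-inj dist f af pres = dist f af (κ-inj ∘ pres)

no-0-colouring : {G : Graph n} → Fin n → ¬ DistColoring G 0
no-0-colouring v (c , _) with c v
... | ()

no-1-colouring : {G : Graph n} {u v : Fin n} → Adj G u v → ¬ DistColoring G 1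
no-1-colouring {u = u} {v} e (c , _ , proper , _) with c u | c v | proper u v e
... | zero | zero | c≢ = c≢ refl

aut-preserves-reach : {G : Graph n} (h : Permutation′ n) → IsAut G h →
                      ∀ {u v} → Reach G u v → Reach G (h ⟨$⟩ʳ u) (h ⟨$⟩ʳ v)
aut-preserves-reach h ah here                = here
aut-preserves-reach h ah (step {u} {v} e r) =
  step (trans (ah u v) e) (aut-preserves-reach h ah r)

reach-distinct⇒edge : {G : Graph n} {u v : Fin n} → Reach G u v → u ≢ v →
                      ∃₂ λ x y → Adj G x y
reach-distinct⇒edge here       u≢u = ⊥-elim (u≢u refl)
reach-distinct⇒edge (step e _) _   = _ , _ , e

-- Bipartitions of a connected graph

bipartition-flips : {G : Graph n} {a : Fin n → Bool} {u v : Fin n} →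
                    IsBipartition G a → Adj G u v → a v ≡ not (a u)
bipartition-flips bip e = ¬-not (λ eq → bip _ _ e (sym eq))

bipartitions-related : {G : Graph n} {a b : Fin n → Bool} (φ : Bool → Bool) →
                       (∀ x → φ (not x) ≡ not (φ x)) →
                       IsBipartition G a → IsBipartition G b →
                       ∀ {u v} → Reach G u v → a u ≡ φ (b u) → a v ≡ φ (b v)
bipartitions-related φ φ-not bip-a bip-b here eq = eq
bipartitions-related {G = G} {a} {b} φ φ-not bip-a bip-b (step {u} {w} e r) eq =
  bipartitions-related φ φ-not bip-a bip-b r (begin
    a w             ≡⟨ bipartition-flips {G = G} bip-a e ⟩
    not (a u)       ≡⟨ cong not eq ⟩
    not (φ (b u))   ≡⟨ sym (φ-not (b u)) ⟩
    φ (not (b u))   ≡⟨ cong φ (sym (bipartition-flips {G = G} bip-b e)) ⟩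
    φ (b w)         ∎)
  where open ≡-Reasoning

bipartitions-agree-or-complement :
  ∀ {n} {G : Graph n} {a b : Fin n → Bool} → Connected G →
  IsBipartition G a → IsBipartition G b →
  (∀ v → a v ≡ b v) ⊎ (∀ v → a v ≡ not (b v))
bipartitions-agree-or-complement {zero} conn bip-a bip-b = inj₁ λ ()
bipartitions-agree-or-complement {suc n} {a = a} {b} conn bip-a bip-b with a zero ≟ᵇ b zero
... | yes agree    =
  inj₁ λ v → bipartitions-related id (λ _ → refl) bip-a bip-b (conn zero v) agree
... | no  disagree =
  inj₂ λ v →
    bipartitions-related not (λ _ → refl) bip-a bip-b (conn zero v) (¬-not disagree)

bipartition-swapped : {G : Graph n} {side a : Fin n → Bool} {f : Fin n → Fin n} →
                      Connected G → IsBipartition G side →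
                      (∀ v → side (f v) ≡ not (side v)) →
                      IsBipartition G a → ∀ v → a (f v) ≡ not (a v)
bipartition-swapped {side = side} {a} {f} conn bip f-swaps bip-a v
  with bipartitions-agree-or-complement conn bip-a bip
... | inj₁ a≗side  =
  trans (a≗side (f v)) (trans (f-swaps v) (cong not (sym (a≗side v))))
... | inj₂ a≗¬side =
  trans (a≗¬side (f v)) (cong not (trans (f-swaps v) (sym (a≗¬side v))))

module _ {G : Graph n} {s : Fin n → Bool} (conn : Connected G)
         (bip : IsBipartition G s) (dist : Distinguishes G s)
         {π : Permutation′ n} (aπ : IsAut G π)
         (π-swaps : ∀ v → s (π ⟨$⟩ʳ v) ≡ not (s v)) where

  swap-inverts-swap : (ρ : Permutation′ n) → IsAut G ρ →
                      (∀ v → s (ρ ⟨$⟩ʳ v) ≡ not (s v)) → ∀ v → π ⟨$⟩ʳ (ρ ⟨$⟩ʳ v) ≡ v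
  swap-inverts-swap ρ aρ ρ-swaps = dist (ρ ∘ₚ π) (λ u v → trans (aπ _ _) (aρ u v))
    (λ v → trans (π-swaps _) (trans (cong not (ρ-swaps v)) (not-involutive (s v))))

  swapping-aut-unique : ∀ h → IsAut G h →
                        IsIdentity h ⊎ (∀ v → h ⟨$⟩ʳ v ≡ π ⟨$⟩ʳ v)
  swapping-aut-unique h ah with bipartitions-agree-or-complement {a = s ∘ (h ⟨$⟩ʳ_)} conn
                                 (λ u v e → bip _ _ (trans (ah u v) e)) bip
  ... | inj₁ preserves = inj₁ (dist h ah preserves)
  ... | inj₂ swaps     = inj₂ λ v → begin
    h ⟨$⟩ʳ v                   ≡⟨ sym (swap-inverts-swap π aπ π-swaps (h ⟨$⟩ʳ v)) ⟩
    π ⟨$⟩ʳ (π ⟨$⟩ʳ (h ⟨$⟩ʳ v)) ≡⟨ cong (π ⟨$⟩ʳ_) (swap-inverts-swap h ah swaps v) ⟩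
    π ⟨$⟩ʳ v                   ∎
    where open ≡-Reasoning

  swapping-aut-fixed-point-free : Fix∅ π
  swapping-aut-fixed-point-free v πv≡v = not-¬ refl (trans (sym (cong s πv≡v)) (π-swaps v))

  swapping-aut⇒special-bipartite : Fin n → SpecialBipartite G
  swapping-aut⇒special-bipartite v =
    s , bip , π ,
    (aπ , (λ π-id → swapping-aut-fixed-point-free v (π-id v)) , swapping-aut-unique) ,
    swapping-aut-fixed-point-free , π-swaps

-- The two copies in G ∪ G

tag : Bool → Fin n → Fin n ⊎ Fin n
tag true  = inj₁
tag false = inj₂

tag-injective : ∀ {b b' : Bool} {x y : Fin n} → tag b x ≡ tag b' y → b ≡ b' × x ≡ y
tag-injective {b = true}  {true}  refl = refl , refl
tag-injective {b = false} {false} refl = refl , refl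
tag-injective {b = true}  {false} ()
tag-injective {b = false} {true}  ()

-- Opaque, so that a goal about inCopy b x is matched against inCopy and not unfolded.
opaque
  inCopy : Bool → Fin n → Fin (n + n)
  inCopy {n} b a = join n n (tag b a)

  splitAt-inCopy : ∀ {n} b (a : Fin n) → splitAt n (inCopy b a) ≡ tag b a
  splitAt-inCopy {n} b a = splitAt-join n n (tag b a)

  locate : ∀ {n} (u : Fin (n + n)) → Σ Bool λ b → Σ (Fin n) λ a → u ≡ inCopy b a
  locate {n} u with splitAt n u | join-splitAt n n u
  ... | inj₁ a | e = true  , a , sym e
  ... | inj₂ a | e = false , a , sym e

inCopy-injective : ∀ {n} {b b'} {x y : Fin n} → inCopy b x ≡ inCopy b' y → b ≡ b' × x ≡ y
inCopy-injective {n} {b} {b'} {x} {y} e = tag-injective (begin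
  tag b x                  ≡⟨ sym (splitAt-inCopy b x) ⟩
  splitAt n (inCopy b x)   ≡⟨ cong (splitAt n) e ⟩
  splitAt n (inCopy b' y)  ≡⟨ splitAt-inCopy b' y ⟩
  tag b' y                 ∎)
  where open ≡-Reasoning

sumAdj : Graph n → Fin n ⊎ Fin n → Fin n ⊎ Fin n → Bool
sumAdj G (inj₁ x) (inj₁ y) = adj G x y
sumAdj G (inj₂ x) (inj₂ y) = adj G x y
sumAdj G (inj₁ _) (inj₂ _) = false
sumAdj G (inj₂ _) (inj₁ _) = false

unionAdj-splitAt : ∀ {n} (G : Graph n) u v →
                   adj (G ∪G G) u v ≡ sumAdj G (splitAt n u) (splitAt n v)
unionAdj-splitAt {n} G u v with splitAt n u | splitAt n v
... | inj₁ _ | inj₁ _ = refl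
... | inj₂ _ | inj₂ _ = refl
... | inj₁ _ | inj₂ _ = refl
... | inj₂ _ | inj₁ _ = refl

unionAdj-inCopy : (G : Graph n) → ∀ b b' (x y : Fin n) →
                  adj (G ∪G G) (inCopy b x) (inCopy b' y) ≡ sumAdj G (tag b x) (tag b' y)
unionAdj-inCopy G b b' x y =
  trans (unionAdj-splitAt G _ _) (cong₂ (sumAdj G) (splitAt-inCopy b x) (splitAt-inCopy b' y))

unionAdj-same-copy : (G : Graph n) → ∀ b (x y : Fin n) →
                     adj (G ∪G G) (inCopy b x) (inCopy b y) ≡ adj G x y
unionAdj-same-copy G true  x y = unionAdj-inCopy G true true x y
unionAdj-same-copy G false x y = unionAdj-inCopy G false false x y

unionAdj⇒same-copy : (G : Graph n) → ∀ b b' (x y : Fin n) →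
                     Adj (G ∪G G) (inCopy b x) (inCopy b' y) → b ≡ b'
unionAdj⇒same-copy G true  true  x y e = refl
unionAdj⇒same-copy G false false x y e = refl
unionAdj⇒same-copy G true  false x y e with trans (sym (unionAdj-inCopy G true false x y)) e
... | ()
unionAdj⇒same-copy G false true  x y e with trans (sym (unionAdj-inCopy G false true x y)) e
... | ()

lift-reach : {G : Graph n} → ∀ b {x y : Fin n} →
             Reach G x y → Reach (G ∪G G) (inCopy b x) (inCopy b y)
lift-reach b here                       = here
lift-reach {G = G} b (step {u} {v} e r) =
  step (trans (unionAdj-same-copy G b u v) e) (lift-reach b r)

reach-stays-in-copy : ∀ {n} {G : Graph n} {b} {x : Fin n} {u} →
                      Reach (G ∪G G) (inCopy b x) u → ∃ λ y → u ≡ inCopy b y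
reach-stays-in-copy {x = x} here = x , refl
reach-stays-in-copy {n} {G} {b} {x} (step {v = w} e r) with locate {n} w
... | b' , y , refl with unionAdj⇒same-copy G b b' x y e
... | refl = reach-stays-in-copy r

colourUnion : (Bool → Fin n → A) → Fin (n + n) → A
colourUnion {n} c u = [ c true , c false ]′ (splitAt n u)

colourUnion-inCopy : (c : Bool → Fin n → A) → ∀ b a → colourUnion c (inCopy b a) ≡ c b a
colourUnion-inCopy c true  a = cong [ c true , c false ]′ (splitAt-inCopy true a)
colourUnion-inCopy c false a = cong [ c true , c false ]′ (splitAt-inCopy false a)

colourUnion-proper : ∀ {n} {G : Graph n} {c : Bool → Fin n → A} →
                     (∀ b → ProperColouring G (c b)) →
                     ProperColouring (G ∪G G) (colourUnion c)
colourUnion-proper {n = n} {G = G} {c = c} proper u v e with locate {n} u | locate {n} v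
... | b , x , refl | b' , y , refl with unionAdj⇒same-copy G b b' x y e
... | refl = λ eq → proper b x y (trans (sym (unionAdj-same-copy G b x y)) e)
               (trans (sym (colourUnion-inCopy c b x)) (trans eq (colourUnion-inCopy c b y)))

MapsCopyTo : Graph n → Permutation′ (n + n) → Bool → Bool → Set
MapsCopyTo {n} G h b b' =
  Σ (Permutation′ n) λ g → IsAut G g × (∀ a → h ⟨$⟩ʳ inCopy b a ≡ inCopy b' (g ⟨$⟩ʳ a))

aut-maps-copy-to-copy : ∀ {n} {G : Graph n} → Connected G → (h : Permutation′ (n + n)) →
                        IsAut (G ∪G G) h → ∀ b → Fin n → Σ Bool (MapsCopyTo G h b)
aut-maps-copy-to-copy {n} {G} conn h ah b v with locate {n} (h ⟨$⟩ʳ inCopy b v)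
... | b' , _ , hv≡ = b' , injective⇒permutation g-injective , g-adj , proj₂ ∘ image
  where
  image : ∀ a → ∃ λ y → h ⟨$⟩ʳ inCopy b a ≡ inCopy b' y
  image a = reach-stays-in-copy (subst (λ w → Reach (G ∪G G) w (h ⟨$⟩ʳ inCopy b a)) hv≡
    (aut-preserves-reach h ah (lift-reach b (conn v a))))
  g : Fin n → Fin n
  g = proj₁ ∘ image
  g-adj : AdjacencyPreserving G g
  g-adj x y = begin
    adj G (g x) (g y)
      ≡⟨ sym (unionAdj-same-copy G b' _ _) ⟩
    adj (G ∪G G) (inCopy b' (g x)) (inCopy b' (g y))
      ≡⟨ sym (cong₂ (adj (G ∪G G)) (proj₂ (image x)) (proj₂ (image y))) ⟩
    adj (G ∪G G) (h ⟨$⟩ʳ inCopy b x) (h ⟨$⟩ʳ inCopy b y)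
      ≡⟨ ah _ _ ⟩
    adj (G ∪G G) (inCopy b x) (inCopy b y)
      ≡⟨ unionAdj-same-copy G b x y ⟩
    adj G x y
      ∎
    where open ≡-Reasoning
  g-injective : Injective _≡_ _≡_ g
  g-injective {x} {y} gx≡gy = proj₂ (inCopy-injective (⟨$⟩ʳ-injective h
    (trans (proj₂ (image x)) (trans (cong (inCopy b') gx≡gy) (sym (proj₂ (image y)))))))

colour-along-copy-map : {c : Bool → Fin n → A} (h : Permutation′ (n + n)) →
                        (∀ u → colourUnion c (h ⟨$⟩ʳ u) ≡ colourUnion c u) →
                        ∀ {b b'} (g : Permutation′ n) →
                        (∀ a → h ⟨$⟩ʳ inCopy b a ≡ inCopy b' (g ⟨$⟩ʳ a)) →
                        ∀ a → c b' (g ⟨$⟩ʳ a) ≡ c b a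
colour-along-copy-map {c = c} h pres {b} {b'} g h≗g a = begin
  c b' (g ⟨$⟩ʳ a)                      ≡⟨ sym (colourUnion-inCopy c b' _) ⟩
  colourUnion c (inCopy b' (g ⟨$⟩ʳ a)) ≡⟨ cong (colourUnion c) (sym (h≗g a)) ⟩
  colourUnion c (h ⟨$⟩ʳ inCopy b a)    ≡⟨ pres (inCopy b a) ⟩
  colourUnion c (inCopy b a)           ≡⟨ colourUnion-inCopy c b a ⟩
  c b a                                ∎
  where open ≡-Reasoning

aut-fixes-preserved-copy : {G : Graph n} {c : Bool → Fin n → A} (h : Permutation′ (n + n)) →
                           (∀ u → colourUnion c (h ⟨$⟩ʳ u) ≡ colourUnion c u) →
                           ∀ b → Distinguishes G (c b) → MapsCopyTo G h b b →
                           ∀ a → h ⟨$⟩ʳ inCopy b a ≡ inCopy b a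
aut-fixes-preserved-copy {c = c} h pres b dist (g , ag , h≗g) a =
  trans (h≗g a) (cong (inCopy b) (dist g ag (colour-along-copy-map {c = c} h pres g h≗g) a))

colourUnion-distinguishes : ∀ {n} {G : Graph n} {c : Bool → Fin n → A} → Connected G →
                            (∀ b → Distinguishes G (c b)) → (h : Permutation′ (n + n)) →
                            IsAut (G ∪G G) h →
                            (∀ u → colourUnion c (h ⟨$⟩ʳ u) ≡ colourUnion c u) →
                            MapsCopyTo G h true true → IsIdentity h
colourUnion-distinguishes {n = n} {G} {c} conn dist h ah pres first-in-place = identity
  where
  fixes : ∀ b → MapsCopyTo G h b b → ∀ a → h ⟨$⟩ʳ inCopy b a ≡ inCopy b a
  fixes b = aut-fixes-preserved-copy {G = G} {c = c} h pres b (dist b)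

  identity : IsIdentity h
  identity u with locate {n} u
  ... | true  , a , refl = fixes true first-in-place a
  ... | false , a , refl with aut-maps-copy-to-copy conn h ah false a
  ...   | false , second-in-place = fixes false second-in-place a
  ...   | true  , (g , _ , h≗g) =
    contradiction (proj₁ (inCopy-injective (⟨$⟩ʳ-injective h (begin
      h ⟨$⟩ʳ inCopy false a            ≡⟨ h≗g a ⟩
      inCopy true (g ⟨$⟩ʳ a)           ≡⟨ sym (fixes true first-in-place (g ⟨$⟩ʳ a)) ⟩
      h ⟨$⟩ʳ inCopy true (g ⟨$⟩ʳ a)    ∎))))
      λ ()
    where open ≡-Reasoning

inCopy-proper : {G : Graph n} {c : Fin (n + n) → A} →
                ProperColouring (G ∪G G) c → ∀ b → ProperColouring G (c ∘ inCopy b)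
inCopy-proper {G = G} proper b x y e = proper _ _ (trans (unionAdj-same-copy G b x y) e)

module _ (π : Permutation′ n) where

  moveBy : Bool → Fin n → Fin n
  moveBy true  = π ⟨$⟩ʳ_
  moveBy false = π ⟨$⟩ˡ_

  private
    swapTagged : Fin n ⊎ Fin n → Fin (n + n)
    swapTagged = [ inCopy false ∘ moveBy true , inCopy true ∘ moveBy false ]′

  swapCopies : Fin (n + n) → Fin (n + n)
  swapCopies = swapTagged ∘ splitAt n

  swapCopies-inCopy : ∀ b a → swapCopies (inCopy b a) ≡ inCopy (not b) (moveBy b a)
  swapCopies-inCopy true  a = cong swapTagged (splitAt-inCopy true a)
  swapCopies-inCopy false a = cong swapTagged (splitAt-inCopy false a)

  swapCopies-involutive : ∀ u → swapCopies (swapCopies u) ≡ u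
  swapCopies-involutive u with locate {n} u
  ... | true  , a , refl = trans (cong swapCopies (swapCopies-inCopy true a))
                             (trans (swapCopies-inCopy false _) (cong (inCopy true) (inverseˡ π)))
  ... | false , a , refl = trans (cong swapCopies (swapCopies-inCopy false a))
                             (trans (swapCopies-inCopy true _) (cong (inCopy false) (inverseʳ π)))

  copySwap : Permutation′ (n + n)
  copySwap = permutation swapCopies swapCopies swapCopies-involutive swapCopies-involutive

  copySwap-aut : {G : Graph n} → IsAut G π → IsAut (G ∪G G) copySwap
  copySwap-aut {G} aπ u v with locate {n} u | locate {n} v
  ... | b , x , refl | b' , y , refl = begin
    adj (G ∪G G) (swapCopies (inCopy b x)) (swapCopies (inCopy b' y))
      ≡⟨ cong₂ (adj (G ∪G G)) (swapCopies-inCopy b x) (swapCopies-inCopy b' y) ⟩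
    adj (G ∪G G) (inCopy (not b) (moveBy b x)) (inCopy (not b') (moveBy b' y))
      ≡⟨ unionAdj-inCopy G _ _ _ _ ⟩
    sumAdj G (tag (not b) (moveBy b x)) (tag (not b') (moveBy b' y))
      ≡⟨ sumAdj-moved b b' ⟩
    sumAdj G (tag b x) (tag b' y)
      ≡⟨ sym (unionAdj-inCopy G b b' x y) ⟩
    adj (G ∪G G) (inCopy b x) (inCopy b' y)
      ∎
    where
    open ≡-Reasoning
    sumAdj-moved : ∀ b b' → sumAdj G (tag (not b) (moveBy b x)) (tag (not b') (moveBy b' y))
                            ≡ sumAdj G (tag b x) (tag b' y)
    sumAdj-moved true  true  = aπ x y
    sumAdj-moved false false = trans (sym (aπ _ _)) (cong₂ (adj G) (inverseʳ π) (inverseʳ π))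
    sumAdj-moved true  false = refl
    sumAdj-moved false true  = refl

copySwap-invariant⇒¬distinguishes : {G : Graph n} {c : Fin (n + n) → A} → Fin n →
                                    (π : Permutation′ n) → IsAut G π →
                                    (∀ a → c (inCopy false (π ⟨$⟩ʳ a)) ≡ c (inCopy true a)) →
                                    ¬ Distinguishes (G ∪G G) c
copySwap-invariant⇒¬distinguishes {n = n} {c = c} v π aπ invariant dist =
  contradiction (proj₁ (inCopy-injective swap-fixes-v)) λ ()
  where
  preserved : ∀ u → c (swapCopies π u) ≡ c u
  preserved u with locate {n} u
  ... | true  , a , refl = trans (cong c (swapCopies-inCopy π true a)) (invariant a)
  ... | false , a , refl = trans (cong c (swapCopies-inCopy π false a))
                             (trans (sym (invariant _)) (cong (c ∘ inCopy false) (inverseʳ π)))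
  swap-fixes-v : inCopy false (π ⟨$⟩ʳ v) ≡ inCopy true v
  swap-fixes-v = trans (sym (swapCopies-inCopy π true v))
                       (dist (copySwap π) (copySwap-aut π aπ) preserved (inCopy true v))

-- Without a side-swapping automorphism, χ_D(G ∪ G) = 2

module _ {G : Graph n} (conn : Connected G) (c₀ : Fin n → Fin 2)
         (c₀-onto : Surjective _≡_ _≡_ c₀) (c₀-proper : Proper G c₀)
         (c₀-dist : Distinguishes G c₀) where

  private
    side : Fin n → Bool
    side = toBool ∘ c₀

    side-bip : IsBipartition G side
    side-bip = proper-∘ {G = G} toBool-injective c₀-proper

    side-dist : Distinguishes G side
    side-dist = distinguishes-∘ {G = G} toBool-injective c₀-dist

    v₀ : Fin n
    v₀ = proj₁ (c₀-onto zero)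

  SwapsSides : (Fin n → Fin n) → Set
  SwapsSides g =
    AdjacencyPreserving G g × Injective _≡_ _≡_ g × (∀ v → side (g v) ≡ not (side v))

  swapsSides? : Dec (∃ SwapsSides)
  swapsSides? = ∃-function? resp decide
    where
    resp : ∀ {f g} → f ≗ g → SwapsSides f → SwapsSides g
    resp f≗g (f-adj , f-inj , f-swaps) =
      (λ u v → trans (sym (cong₂ (adj G) (f≗g u) (f≗g v))) (f-adj u v)) ,
      (λ e → f-inj (trans (f≗g _) (trans e (sym (f≗g _))))) ,
      (λ v → trans (sym (cong side (f≗g v))) (f-swaps v))
    injective? : ∀ g → Dec (Injective _≡_ _≡_ g)
    injective? g = map′ (λ inj → inj _ _) (λ inj _ _ → inj)
                        (all? λ u → all? λ v → (g u ≟ g v) →-dec (u ≟ v))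
    decide : ∀ g → Dec (SwapsSides g)
    decide g = all? (λ u → all? λ v → adj G (g u) (g v) ≟ᵇ adj G u v) ×-dec
               injective? g ×-dec
               all? (λ v → side (g v) ≟ᵇ not (side v))

  twinColouring : Bool → Fin n → Fin 2
  twinColouring true  = c₀
  twinColouring false = fromBool ∘ not ∘ side

  private
    fromBool∘not-injective : Injective _≡_ _≡_ (fromBool ∘ not)
    fromBool∘not-injective = not-injective ∘ fromBool-injective

    twin-proper : ∀ b → ProperColouring G (twinColouring b)
    twin-proper true  = c₀-proper
    twin-proper false = proper-∘ {G = G} fromBool∘not-injective side-bip

    twin-dist : ∀ b → Distinguishes G (twinColouring b)
    twin-dist true  = c₀-dist
    twin-dist false = distinguishes-∘ {G = G} fromBool∘not-injective side-dist

    twin-onto : Surjective _≡_ _≡_ (colourUnion twinColouring)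
    twin-onto = strictlySurjective⇒surjective λ k →
      let (v , c₀v≡k) = surjective⇒strictlySurjective c₀-onto k
      in inCopy true v , trans (colourUnion-inCopy twinColouring true v) c₀v≡k

  twinColouring-distinguishes : ¬ ∃ SwapsSides →
                                Distinguishes (G ∪G G) (colourUnion twinColouring)
  twinColouring-distinguishes no-swap h ah pres with aut-maps-copy-to-copy conn h ah true v₀
  ... | true  , in-place       = colourUnion-distinguishes conn twin-dist h ah pres in-place
  ... | false , (g , ag , h≗g) =
    ⊥-elim (no-swap (g ⟨$⟩ʳ_ , ag , ⟨$⟩ʳ-injective g , g-swaps))
    where
    g-swaps : ∀ x → side (g ⟨$⟩ʳ x) ≡ not (side x)
    g-swaps x = trans (sym (not-involutive _)) (cong not (trans (sym (toBool-fromBool _))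
                  (cong toBool (colour-along-copy-map {c = twinColouring} h pres g h≗g x))))

  ¬χ₂-union⇒special-bipartite : ¬ DistColoring (G ∪G G) 2 → SpecialBipartite G
  ¬χ₂-union⇒special-bipartite no-2 with swapsSides?
  ... | yes (g , g-adj , g-inj , g-swaps) =
    swapping-aut⇒special-bipartite conn side-bip side-dist
      {π = injective⇒permutation g-inj} g-adj g-swaps v₀
  ... | no no-swap = ⊥-elim (no-2 (colourUnion twinColouring , twin-onto ,
                                   colourUnion-proper twin-proper ,
                                   twinColouring-distinguishes no-swap))

-- With a side-swapping automorphism, χ_D(G ∪ G) = 3

shade : Bool → Bool → Fin 3
shade _     false = zero
shade true  true  = suc zero
shade false true  = suc (suc zero)

shade-injective : ∀ b → Injective _≡_ _≡_ (shade b)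
shade-injective _     {false} {false} _ = refl
shade-injective true  {true}  {true}  _ = refl
shade-injective false {true}  {true}  _ = refl
shade-injective true  {false} {true}  ()
shade-injective true  {true}  {false} ()
shade-injective false {false} {true}  ()
shade-injective false {true}  {false} ()

shade-false≢1 : ∀ s → shade false s ≢ suc zero
shade-false≢1 false ()
shade-false≢1 true  ()

module _ {G : Graph n} (conn : Connected G) (v₀ : Fin n) (side : Fin n → Bool)
         (bip : IsBipartition G side) (f : Permutation′ n) (af : IsAut G f)
         (aut-id-or-f : ∀ g → IsAut G g → IsIdentity g ⊎ (∀ v → g ⟨$⟩ʳ v ≡ f ⟨$⟩ʳ v))
         (f-fixed-point-free : Fix∅ f)
         (f-swaps : ∀ v → side (f ⟨$⟩ʳ v) ≡ not (side v)) where

  private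
    side-dist : Distinguishes G side
    side-dist g ag pres with aut-id-or-f g ag
    ... | inj₁ g-id = g-id
    ... | inj₂ g≗f  = ⊥-elim (not-¬ refl
                        (trans (sym (pres v₀)) (trans (cong side (g≗f v₀)) (f-swaps v₀))))

    side-attains : ∀ b → ∃ λ v → side v ≡ b
    side-attains b with side v₀ ≟ᵇ b
    ... | yes e = v₀ , e
    ... | no ne = f ⟨$⟩ʳ v₀ , trans (f-swaps v₀) (sym (¬-not (ne ∘ sym)))

  triColouring : Bool → Fin n → Fin 3
  triColouring b = shade b ∘ side

  private
    shade-at : ∀ b {s} → (v : ∃ λ v → side v ≡ s) →
               colourUnion triColouring (inCopy b (proj₁ v)) ≡ shade b s
    shade-at b (v , e) = trans (colourUnion-inCopy triColouring b v) (cong (shade b) e)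

    tri-onto : Surjective _≡_ _≡_ (colourUnion triColouring)
    tri-onto = strictlySurjective⇒surjective λ where
      zero             → _ , shade-at true  (side-attains false)
      (suc zero)       → _ , shade-at true  (side-attains true)
      (suc (suc zero)) → _ , shade-at false (side-attains true)

    tri-dist : Distinguishes (G ∪G G) (colourUnion triColouring)
    tri-dist h ah pres with aut-maps-copy-to-copy conn h ah true (proj₁ (side-attains true))
    ... | true  , in-place      =
      colourUnion-distinguishes conn (λ b → distinguishes-∘ {G = G} (shade-injective b) side-dist)
        h ah pres in-place
    ... | false , (g , _ , h≗g) = ⊥-elim (shade-false≢1 _
      (trans (colour-along-copy-map {c = triColouring} h pres g h≗g _)
             (cong (shade true) (proj₂ (side-attains true)))))

    no-2-colouring : ¬ DistColoring (G ∪G G) 2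
    no-2-colouring (c , _ , c-proper , c-dist) =
      [ (λ same → copySwap-invariant⇒¬distinguishes v₀ Perm.id (λ _ _ → refl)
                    (λ a → toBool-injective (same a)) c-dist)
      , (λ opposite → copySwap-invariant⇒¬distinguishes v₀ f af
                        (λ a → toBool-injective (trans (opposite (f ⟨$⟩ʳ a))
                          (trans (cong not (bipartition-swapped conn bip f-swaps (part-bip true) a))
                                 (not-involutive _))))
                        c-dist)
      ]′ (bipartitions-agree-or-complement conn (part-bip false) (part-bip true))
      where
      part-bip : ∀ b → IsBipartition G (toBool ∘ c ∘ inCopy b)
      part-bip b = proper-∘ {G = G} toBool-injective (inCopy-proper {G = G} c-proper b)

  χ₃-union : ChiD≡ (G ∪G G) 3
  χ₃-union = (colourUnion triColouring , tri-onto ,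
              colourUnion-proper (λ b → proper-∘ {G = G} (shade-injective b) bip) , tri-dist) ,
             fewer-colours
    where
    fewer-colours : ∀ j → j < 3 → ¬ DistColoring (G ∪G G) j
    fewer-colours 0 _ = no-0-colouring {G = G ∪G G} (inCopy true v₀)
    fewer-colours 1 _ with reach-distinct⇒edge (conn v₀ (f ⟨$⟩ʳ v₀)) (f-fixed-point-free v₀ ∘ sym)
    ... | x , y , e = no-1-colouring {G = G ∪G G} (trans (unionAdj-same-copy G true x y) e)
    fewer-colours 2 _ = no-2-colouring
    fewer-colours (suc (suc (suc j))) (s≤s (s≤s (s≤s ())))

theorem5p4 : ∀ {n : ℕ} (G : Graph n) → Connected G → ChiD≡ G 2 →
    (ChiD≡ (G ∪G G) 3 ⇔ SpecialBipartite G)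
theorem5p4 G conn ((c₀ , c₀-onto , c₀-proper , c₀-dist) , _) = mk⇔
  (λ (_ , fewer-colours) →
     ¬χ₂-union⇒special-bipartite conn c₀ c₀-onto c₀-proper c₀-dist (fewer-colours 2 (n<1+n 2)))
  (λ (side , bip , f , (af , _ , aut-id-or-f) , f-fixed-point-free , f-swaps) →
     χ₃-union conn (proj₁ (c₀-onto zero)) side bip f af aut-id-or-f f-fixed-point-free f-swaps)
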